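{- Let $k\le l$ be positive integers with $\gcd(k,l)=1$, let $n\ge1$ and $m\ge0$ be integers, and write $m=qn+r$ with integers $q\ge0$, $0\le r<n$. If $r=0$, then $L^{k,l}(m,n)=nkq$, and this value is attained at the $nk\times nl$ matrix all of whose entries equal $q$.
   Context: $\mathcal D^{k,l}(m,n)$ denotes the set of all $nk\times nl$ matrices with nonnegative integer entries all of whose row sums equal $ml$ and all of whose column sums equal $mk$. For an $s\times t$ matrix $A$ with $s\le t$, a transversal is a set of $s$ entries of $A$, one from each row, no two in the same column; if $s>t$, the transversals of $A$ are those of its transpose. For a transversal $T$, $|T|$ is the sum of its entries. The tropical determinant is ${\rm tdet}(A)=\max_T |T|$ over all transversals $T$ of $A$. Finally $L^{k,l}(m,n)=\min_{A\in\mathcal D^{k,l}(m,n)}{\rm tdet}(A)$. -}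

module Defs where

open import Data.Nat using (ℕ; zero; suc; _+_; _*_; _≤_)
open import Data.Fin using (Fin; zero; suc)
open import Data.Product using (Σ; ∃; _×_)
open import Function.Definitions using (Injective)
open import Relation.Binary.PropositionalEquality using (_≡_)

Matrix : ℕ → ℕ → Set
Matrix s t = Fin s → Fin t → ℕ

∑ : ∀ {s} → (Fin s → ℕ) → ℕ
∑ {zero}  f = 0
∑ {suc s} f = f zero + ∑ (λ i → f (suc i))

rowSum : ∀ {s t} → Matrix s t → Fin s → ℕ
rowSum A i = ∑ (λ j → A i j)

colSum : ∀ {s t} → Matrix s t → Fin t → ℕ
colSum A j = ∑ (λ i → A i j)

InD : (k l m n : ℕ) → Matrix (n * k) (n * l) → Set
InD k l m n A = (∀ i → rowSum A i ≡ m * l) × (∀ j → colSum A j ≡ m * k)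

-- Transversal of an s × t matrix with s ≤ t: one entry from each row,
-- no two in the same column, i.e. an injective map rows → columns.
Transversal : ℕ → ℕ → Set
Transversal s t = Σ (Fin s → Fin t) (Injective _≡_ _≡_)

weight : ∀ {s t} → Matrix s t → Transversal s t → ℕ
weight A (σ Data.Product., _) = ∑ (λ i → A i (σ i))

IsTDet : ∀ {s t} → Matrix s t → ℕ → Set
IsTDet {s} {t} A v = (∃ λ (T : Transversal s t) → weight A T ≡ v)
                   × (∀ (T : Transversal s t) → weight A T ≤ v)

TDetAtLeast : ∀ {s t} → Matrix s t → ℕ → Set
TDetAtLeast {s} {t} A v = ∃ λ (T : Transversal s t) → v ≤ weight A T

constMat : ∀ {s t} → ℕ → Matrix s t
constMat q _ _ = q

module Submission where

-- The upper bound is immediate: every transversal of the constant matrix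
-- has weight (#rows)·q.  The lower bound is a double-counting argument
-- valid for any M × N matrix with M ≤ N.  Identify the columns with the
-- cyclic group ℤ/N and, for every shift c, take the "broken diagonal"
-- transversal i ↦ i + c.  For a fixed row i the entries i + c run over all
-- columns exactly once as c varies (rotation is a permutation), so the N
-- diagonal weights add up to the sum of all entries of A.  By averaging,
-- some diagonal weighs at least (total)/N; for A ∈ D^{k,l}(qn,n) the total
-- is nk · qnl, giving the bound nkq.  (Neither gcd(k,l) = 1 nor r < n is
-- needed for this case.)

open import Defs
open import Data.Nat using (ℕ; zero; suc; _+_; _*_; _∸_; _≤_; _<_; _≤?_; NonZero; >-nonZero)
open import Data.Nat.GCD using (gcd)
open import Data.Nat.Properties
open import Data.Nat.DivMod using (_%_; m%n<n; %-distribˡ-+; m%n%n≡m%n; [m+n]%n≡m%n; m<n⇒m%n≡m)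
open import Data.Nat.Tactic.RingSolver using (solve-∀)
open import Data.Fin using (Fin; toℕ; fromℕ<; inject≤)
open import Data.Fin.Properties using (toℕ-injective; toℕ-fromℕ<; toℕ<n; inject≤-injective)
open import Data.Fin.Permutation using (Permutation; permutation; _⟨$⟩ʳ_)
open import Data.Product using (_×_; ∃; _,_; map)
open import Function using (id)
open import Relation.Binary.PropositionalEquality using (_≡_; refl; sym; trans; cong; cong₂; module ≡-Reasoning)
open import Relation.Nullary using (yes; no)
open import Algebra.Properties.CommutativeMonoid.Sum +-0-commutativeMonoid
  using (sum; ∑-comm; ∑-permute)

-- The sum ∑ of the definitions is the library's monoid sum, so the
-- library's interchange and reindexing theorems apply to it.
∑≡sum : ∀ {s} (f : Fin s → ℕ) → ∑ f ≡ sum f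
∑≡sum {zero}  f = refl
∑≡sum {suc s} f = cong (f Fin.zero +_) (∑≡sum (λ i → f (Fin.suc i)))

∑-cong : ∀ {s} {f g : Fin s → ℕ} → (∀ i → f i ≡ g i) → ∑ f ≡ ∑ g
∑-cong {zero}  f≗g = refl
∑-cong {suc s} f≗g = cong₂ _+_ (f≗g Fin.zero) (∑-cong (λ i → f≗g (Fin.suc i)))

∑-const : ∀ s q → ∑ {s} (λ _ → q) ≡ s * q
∑-const zero    q = refl
∑-const (suc s) q = cong (q +_) (∑-const s q)

∑-swap : ∀ {s t} (G : Fin s → Fin t → ℕ) →
         ∑ (λ c → ∑ (λ i → G c i)) ≡ ∑ (λ i → ∑ (λ c → G c i))
∑-swap G = begin
  ∑ (λ c → ∑ (λ i → G c i))     ≡⟨ ∑-cong (λ c → ∑≡sum (G c)) ⟩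
  ∑ (λ c → sum (λ i → G c i))   ≡⟨ ∑≡sum (λ c → sum (λ i → G c i)) ⟩
  sum (λ c → sum (λ i → G c i)) ≡⟨ ∑-comm G ⟩
  sum (λ i → sum (λ c → G c i)) ≡⟨ sym (∑≡sum (λ i → sum (λ c → G c i))) ⟩
  ∑ (λ i → sum (λ c → G c i))   ≡⟨ sym (∑-cong (λ i → ∑≡sum (λ c → G c i))) ⟩
  ∑ (λ i → ∑ (λ c → G c i))     ∎
  where open ≡-Reasoning

∑-reindex : ∀ {s} (f : Fin s → ℕ) (π : Permutation s s) → ∑ (λ c → f (π ⟨$⟩ʳ c)) ≡ ∑ f
∑-reindex f π = begin
  ∑ (λ c → f (π ⟨$⟩ʳ c))   ≡⟨ ∑≡sum (λ c → f (π ⟨$⟩ʳ c)) ⟩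
  sum (λ c → f (π ⟨$⟩ʳ c)) ≡⟨ sym (∑-permute f π) ⟩
  sum f                    ≡⟨ sym (∑≡sum f) ⟩
  ∑ f                      ∎
  where open ≡-Reasoning

someTermAtLeastAverage : ∀ s (w : Fin (suc s) → ℕ) B → suc s * B ≤ ∑ w → ∃ λ c → B ≤ w c
someTermAtLeastAverage zero w B total = Fin.zero , (begin
  B              ≡⟨ sym (+-identityʳ B) ⟩
  B + 0          ≤⟨ total ⟩
  w Fin.zero + 0 ≡⟨ +-identityʳ (w Fin.zero) ⟩
  w Fin.zero     ∎)
  where open ≤-Reasoning
someTermAtLeastAverage (suc s) w B total with B ≤? w Fin.zero
... | yes B≤w₀ = Fin.zero , B≤w₀
... | no  B≰w₀ = map Fin.suc id (someTermAtLeastAverage s (λ i → w (Fin.suc i)) B restTotal)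
  where
  -- w₀ < B, so the remaining s + 1 terms carry at least (s + 1)·B.
  restTotal : suc s * B ≤ ∑ (λ i → w (Fin.suc i))
  restTotal = +-cancelˡ-≤ B _ _ (≤-trans total (+-monoˡ-≤ _ (<⇒≤ (≰⇒> B≰w₀))))

someTermAtLeastAverage′ : ∀ {s} .{{_ : NonZero s}} (w : Fin s → ℕ) B → s * B ≤ ∑ w →
                          ∃ λ c → B ≤ w c
someTermAtLeastAverage′ {suc s} = someTermAtLeastAverage s

%-absorbˡ : ∀ a b d .{{_ : NonZero d}} → (a % d + b) % d ≡ (a + b) % d
%-absorbˡ a b d = begin
  (a % d + b) % d         ≡⟨ %-distribˡ-+ (a % d) b d ⟩
  (a % d % d + b % d) % d ≡⟨ cong (λ x → (x + b % d) % d) (m%n%n≡m%n a d) ⟩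
  (a % d + b % d) % d     ≡⟨ sym (%-distribˡ-+ a b d) ⟩
  (a + b) % d             ∎
  where open ≡-Reasoning

module Cyclic (N : ℕ) .{{_ : NonZero N}} where

  reduce : ℕ → Fin N
  reduce t = fromℕ< (m%n<n t N)

  toℕ-reduce : ∀ t → toℕ (reduce t) ≡ t % N
  toℕ-reduce t = toℕ-fromℕ< (m%n<n t N)

  +N-% : ∀ (x : Fin N) → (toℕ x + N) % N ≡ toℕ x
  +N-% x = trans ([m+n]%n≡m%n (toℕ x) N) (m<n⇒m%n≡m (toℕ<n x))

  reduce-wrap : ∀ u v (x : Fin N) → u + v ≡ toℕ x + N → reduce (toℕ (reduce u) + v) ≡ x
  reduce-wrap u v x u+v≡x+N = toℕ-injective (begin
    toℕ (reduce (toℕ (reduce u) + v)) ≡⟨ toℕ-reduce (toℕ (reduce u) + v) ⟩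
    (toℕ (reduce u) + v) % N          ≡⟨ cong (λ y → (y + v) % N) (toℕ-reduce u) ⟩
    (u % N + v) % N                   ≡⟨ %-absorbˡ u v N ⟩
    (u + v) % N                       ≡⟨ cong (_% N) u+v≡x+N ⟩
    (toℕ x + N) % N                   ≡⟨ +N-% x ⟩
    toℕ x                             ∎)
    where open ≡-Reasoning

  infixl 6 _⊕_ _⊖_

  _⊕_ : Fin N → Fin N → Fin N
  x ⊕ a = reduce (toℕ x + toℕ a)

  _⊖_ : Fin N → Fin N → Fin N
  x ⊖ a = reduce (toℕ x + (N ∸ toℕ a))

  ⊕-comm : ∀ x a → x ⊕ a ≡ a ⊕ x
  ⊕-comm x a = cong reduce (+-comm (toℕ x) (toℕ a))

  ⊕-⊖-cancel : ∀ x a → x ⊕ a ⊖ a ≡ x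
  ⊕-⊖-cancel x a = reduce-wrap (toℕ x + toℕ a) (N ∸ toℕ a) x (begin
    toℕ x + toℕ a + (N ∸ toℕ a)   ≡⟨ +-assoc (toℕ x) (toℕ a) (N ∸ toℕ a) ⟩
    toℕ x + (toℕ a + (N ∸ toℕ a)) ≡⟨ cong (toℕ x +_) (m+[n∸m]≡n (<⇒≤ (toℕ<n a))) ⟩
    toℕ x + N                     ∎)
    where open ≡-Reasoning

  ⊖-⊕-cancel : ∀ x a → x ⊖ a ⊕ a ≡ x
  ⊖-⊕-cancel x a = reduce-wrap (toℕ x + (N ∸ toℕ a)) (toℕ a) x (begin
    toℕ x + (N ∸ toℕ a) + toℕ a   ≡⟨ +-assoc (toℕ x) (N ∸ toℕ a) (toℕ a) ⟩
    toℕ x + (N ∸ toℕ a + toℕ a)   ≡⟨ cong (toℕ x +_) (m∸n+n≡m (<⇒≤ (toℕ<n a))) ⟩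
    toℕ x + N                     ∎)
    where open ≡-Reasoning

  rotation : Fin N → Permutation N N
  rotation a = permutation (_⊕ a) (_⊖ a) (λ y → ⊖-⊕-cancel y a) (λ x → ⊕-⊖-cancel x a)

module Diagonals {M N : ℕ} .{{_ : NonZero N}} (M≤N : M ≤ N) where

  open Cyclic N

  column : Fin N → Fin M → Fin N
  column c i = inject≤ i M≤N ⊕ c

  column-injective : ∀ c {i j} → column c i ≡ column c j → i ≡ j
  column-injective c {i} {j} same = inject≤-injective M≤N M≤N i j (begin
    inject≤ i M≤N         ≡⟨ sym (⊕-⊖-cancel (inject≤ i M≤N) c) ⟩
    inject≤ i M≤N ⊕ c ⊖ c ≡⟨ cong (_⊖ c) same ⟩
    inject≤ j M≤N ⊕ c ⊖ c ≡⟨ ⊕-⊖-cancel (inject≤ j M≤N) c ⟩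
    inject≤ j M≤N         ∎)
    where open ≡-Reasoning

  diagonal : Fin N → Transversal M N
  diagonal c = column c , column-injective c

  -- As the shift varies, the diagonals meet row i once in every column.
  diagonalsThroughRow : (A : Matrix M N) → ∀ i → ∑ (λ c → A i (column c i)) ≡ rowSum A i
  diagonalsThroughRow A i = begin
    ∑ (λ c → A i (inject≤ i M≤N ⊕ c))             ≡⟨ ∑-cong (λ c → cong (A i) (⊕-comm (inject≤ i M≤N) c)) ⟩
    ∑ (λ c → A i (rotation (inject≤ i M≤N) ⟨$⟩ʳ c)) ≡⟨ ∑-reindex (A i) (rotation (inject≤ i M≤N)) ⟩
    rowSum A i                                    ∎
    where open ≡-Reasoning

  diagonalsTotal : (A : Matrix M N) → ∑ (λ c → weight A (diagonal c)) ≡ ∑ (rowSum A)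
  diagonalsTotal A = trans (∑-swap (λ c i → A i (column c i))) (∑-cong (diagonalsThroughRow A))

  tdetAtLeastAverage : (A : Matrix M N) (B : ℕ) → N * B ≤ ∑ (rowSum A) → TDetAtLeast A B
  tdetAtLeastAverage A B NB≤total =
    map diagonal id (someTermAtLeastAverage′ (λ c → weight A (diagonal c)) B
      (≤-trans NB≤total (≤-reflexive (sym (diagonalsTotal A)))))

inclusion : ∀ {s t} → s ≤ t → Transversal s t
inclusion s≤t = (λ i → inject≤ i s≤t) , λ {i} {j} → inject≤-injective s≤t s≤t i j

constMat-tdet : ∀ {s t} q → s ≤ t → IsTDet {s} {t} (constMat q) (s * q)
constMat-tdet {s} q s≤t = (inclusion s≤t , ∑-const s q) , λ { (_ , _) → ≤-reflexive (∑-const s q) }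

-- Arithmetic of D^{k,l}(qn, n): the constant matrix q has row sums
-- (nl)q = (qn)l and column sums (nk)q = (qn)k, and a matrix with row sums
-- (qn)l has entry total (nk)(qn)l = (nl)(nkq).
lineSum-const : ∀ q n l → n * l * q ≡ (q * n + 0) * l
lineSum-const = solve-∀

entryTotal : ∀ q n k l → n * k * ((q * n + 0) * l) ≡ n * l * (n * k * q)
entryTotal = solve-∀

constMat-InD : ∀ k l q n → InD k l (q * n + 0) n (constMat q)
constMat-InD k l q n =
  (λ i → trans (∑-const (n * l) q) (lineSum-const q n l)) ,
  (λ j → trans (∑-const (n * k) q) (lineSum-const q n k))

InD-tdetAtLeast : ∀ k l q n → 1 ≤ k → k ≤ l → 1 ≤ n →
                  (A : Matrix (n * k) (n * l)) → InD k l (q * n + 0) n A →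
                  TDetAtLeast A (n * k * q)
InD-tdetAtLeast k l q n 1≤k k≤l 1≤n A (rows , _) =
  tdetAtLeastAverage A (n * k * q) (≤-reflexive (sym (begin
    ∑ (rowSum A)                      ≡⟨ ∑-cong rows ⟩
    ∑ {n * k} (λ _ → (q * n + 0) * l) ≡⟨ ∑-const (n * k) ((q * n + 0) * l) ⟩
    n * k * ((q * n + 0) * l)         ≡⟨ entryTotal q n k l ⟩
    n * l * (n * k * q)               ∎)))
  where
  open ≡-Reasoning
  instance
    columnsNonZero : NonZero (n * l)
    columnsNonZero = m*n≢0 n l {{>-nonZero 1≤n}} {{>-nonZero (≤-trans 1≤k k≤l)}}
  open Diagonals (*-monoʳ-≤ n k≤l)

mainTheorem9 : (k l n m q r : ℕ) → 1 ≤ k → k ≤ l → gcd k l ≡ 1 → 1 ≤ n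
    → m ≡ q * n + r → r < n → r ≡ 0
    → InD k l m n (constMat q)
    × IsTDet {n * k} {n * l} (constMat q) (n * k * q)
    × (∀ (A : Matrix (n * k) (n * l)) → InD k l m n A → TDetAtLeast A (n * k * q))
mainTheorem9 k l n m q r 1≤k k≤l _ 1≤n refl _ refl =
  constMat-InD k l q n ,
  constMat-tdet q (*-monoʳ-≤ n k≤l) ,
  InD-tdetAtLeast k l q n 1≤k k≤l 1≤n
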